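{- Let $\varphi=\frac{1+\sqrt5}{2}$, let $F=0100101001001010010\ldots$ be the Fibonacci word (the cutting sequence of the line $y=\varphi x$), and let $S^M=01020101020102010102\ldots$ be the ternary word obtained from $F$ by replacing every factor $00$ by $020$. If a finite word $u=u_1\cdots u_n$ is a factor of $S^M$, then its reverse $u^r=u_nu_{n-1}\cdots u_1$ is also a factor of $S^M$.
   Context: The cutting sequence of a line $y=\lambda x$ ($\lambda>0$) is the binary word obtained by following the line from the origin and writing $0$ for each meeting with a horizontal grid line $y=k$ and $1$ for each meeting with a vertical grid line $x=k$ ($k$ a positive integer). A factor of an infinite word is a finite block of consecutive letters of it. -}

module Defs where

open import Data.Nat using (ℕ; zero; suc; _+_; _*_; _∸_; _≤ᵇ_; _<ᵇ_)
open import Data.Bool using (Bool; true; false; _∨_; if_then_else_)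
open import Data.List using (List; []; _∷_; _++_; replicate; length; filterᵇ; upTo; map)
open import Data.Product using (∃; ∃₂)
open import Relation.Binary.PropositionalEquality using (_≡_)

Word : Set
Word = List ℕ

FactorOf : Word → Word → Set
FactorOf u w = ∃₂ λ xs ys → xs ++ u ++ ys ≡ w

-- ltφ k m = true iff k < m·φ, where φ = (1+√5)/2.
-- k < m(1+√5)/2  ⇔  2k − m < m√5  ⇔  2k ≤ m  or  (2k − m)² < 5m².
ltφ : ℕ → ℕ → Bool
ltφ k m = ((k + k) ≤ᵇ m) ∨ (((k + k ∸ m) * (k + k ∸ m)) <ᵇ (5 * (m * m)))

-- h m = number of horizontal grid lines y = k (k ≥ 1) met by the line y = φx
-- strictly before it meets the vertical line x = m, i.e. #{k ≥ 1 : k < mφ}.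
-- Since mφ < 2m + 1, it suffices to test k ∈ {1, …, 2m}.
h : ℕ → ℕ
h m = length (filterᵇ (λ k → ltφ k m) (map suc (upTo (m + m))))

-- The prefix of the Fibonacci word F (cutting sequence of y = φx) up to and
-- including the M-th meeting with a vertical line: between the meetings with
-- x = m−1 and x = m the line meets h m ∸ h (m−1) horizontal lines (letter 0),
-- then meets x = m (letter 1).  (No corner is ever hit since φ is irrational.)
fibPrefix : ℕ → Word
fibPrefix zero    = []
fibPrefix (suc M) = fibPrefix M ++ replicate (h (suc M) ∸ h M) 0 ++ (1 ∷ [])

ins2 : Word → Word
ins2 (0 ∷ 0 ∷ w) = 0 ∷ 2 ∷ ins2 (0 ∷ w)
ins2 (a ∷ w)     = a ∷ ins2 w
ins2 []          = []

FactorOfF : Word → Set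
FactorOfF u = ∃ λ M → FactorOf u (fibPrefix M)

-- u is a factor of S^M: it occurs in the image of some prefix of F under ins2
-- (ins2 (fibPrefix M) is a prefix of S^M, and these prefixes exhaust S^M).
FactorOfSM : Word → Set
FactorOfSM u = ∃ λ M → FactorOf u (ins2 (fibPrefix M))

-- S^M arises from F by a substitution that commutes with reversal and maps factors to factors,
-- so it suffices that the reverse of every prefix of F occurs in F.  F is the concatenation of the
-- blocks 0^(rₘ) 1 with rₘ = ⌊(m + 1)φ⌋ − ⌊mφ⌋, and ⌊xφ⌋ + ⌊(Fₙ − x)φ⌋ = Fₙ₊₁ − 1 for 0 < x < Fₙ
-- (Fibonacci numbers Fₙ) makes r₁ ⋯ r_(Fₙ − 2) a palindrome; that identity is the best approximation
-- property of the convergents Fₙ₊₁/Fₙ of φ.  Real numbers are replaced by exact arithmetic in ℤ[φ],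
-- where the sign of a + bφ is found by Euclid's algorithm.
module Submission where

open import Defs
open import Data.List using (reverse)
open import Data.Product using (_,_)
open import Relation.Binary.PropositionalEquality using (subst; sym)

module GoldenIntegers where

  open import Data.Nat as ℕ using (ℕ; zero; suc; z≤n; s≤s)
  import Data.Nat.Properties as ℕ
  open import Data.Integer using (ℤ; +_; -[1+_]; _+_; -_)
  import Data.Integer.Properties as ℤ
  open import Data.Integer.Tactic.RingSolver using (solve-∀)
  open import Algebra.Properties.CommutativeSemigroup ℤ.+-commutativeSemigroup using (interchange)
  open import Data.Product using (Σ; _,_; _×_)
  open import Data.Sum using (_⊎_; inj₁; inj₂)
  open import Data.Empty using (⊥-elim)
  open import Relation.Nullary using (¬_)
  open import Relation.Binary using (tri<; tri≈; tri>)
  open import Relation.Binary.PropositionalEquality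

  -- ⟨ a , b ⟩ stands for a + bφ, where φ² = φ + 1.
  data ℤ[φ] : Set where
    ⟨_,_⟩ : ℤ → ℤ → ℤ[φ]

  infixl 6 _+ᵠ_ _-ᵠ_
  infix 8 -ᵠ_

  0ᵠ : ℤ[φ]
  0ᵠ = ⟨ + 0 , + 0 ⟩

  _+ᵠ_ : ℤ[φ] → ℤ[φ] → ℤ[φ]
  ⟨ a , b ⟩ +ᵠ ⟨ c , d ⟩ = ⟨ a + c , b + d ⟩

  -ᵠ_ : ℤ[φ] → ℤ[φ]
  -ᵠ ⟨ a , b ⟩ = ⟨ - a , - b ⟩

  _-ᵠ_ : ℤ[φ] → ℤ[φ] → ℤ[φ]
  p -ᵠ q = p +ᵠ -ᵠ q

  φ·_ : ℤ[φ] → ℤ[φ]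
  φ· ⟨ a , b ⟩ = ⟨ b , a + b ⟩

  φ^_·_ : ℕ → ℤ[φ] → ℤ[φ]
  φ^ zero  · p = p
  φ^ suc n · p = φ· (φ^ n · p)

  -- δ a m stands for mφ − a.
  δ : ℤ → ℕ → ℤ[φ]
  δ a m = ⟨ - a , + m ⟩

  +ᵠ-identityˡ : ∀ p → 0ᵠ +ᵠ p ≡ p
  +ᵠ-identityˡ ⟨ a , b ⟩ = cong₂ ⟨_,_⟩ (ℤ.+-identityˡ a) (ℤ.+-identityˡ b)

  +ᵠ-identityʳ : ∀ p → p +ᵠ 0ᵠ ≡ p
  +ᵠ-identityʳ ⟨ a , b ⟩ = cong₂ ⟨_,_⟩ (ℤ.+-identityʳ a) (ℤ.+-identityʳ b)

  -ᵠ-involutive : ∀ p → -ᵠ -ᵠ p ≡ p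
  -ᵠ-involutive ⟨ a , b ⟩ = cong₂ ⟨_,_⟩ (ℤ.neg-involutive a) (ℤ.neg-involutive b)

  φ·-distrib-+ᵠ : ∀ p q → φ· (p +ᵠ q) ≡ φ· p +ᵠ φ· q
  φ·-distrib-+ᵠ ⟨ a , b ⟩ ⟨ c , d ⟩ = cong ⟨ b + d ,_⟩ (interchange a c b d)

  φ·-neg-comm : ∀ p → φ· (-ᵠ p) ≡ -ᵠ φ· p
  φ·-neg-comm ⟨ a , b ⟩ = cong ⟨ - b ,_⟩ (sym (ℤ.neg-distrib-+ a b))

  φ^-distrib-+ᵠ : ∀ n p q → φ^ n · (p +ᵠ q) ≡ φ^ n · p +ᵠ φ^ n · q
  φ^-distrib-+ᵠ zero    p q = refl
  φ^-distrib-+ᵠ (suc n) p q = trans (cong φ·_ (φ^-distrib-+ᵠ n p q)) (φ·-distrib-+ᵠ _ _)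

  φ^-neg-comm : ∀ n p → φ^ n · (-ᵠ p) ≡ -ᵠ φ^ n · p
  φ^-neg-comm zero    p = refl
  φ^-neg-comm (suc n) p = trans (cong φ·_ (φ^-neg-comm n p)) (φ·-neg-comm _)

  φ^-φ·-comm : ∀ n p → φ^ n · (φ· p) ≡ φ· (φ^ n · p)
  φ^-φ·-comm zero    p = refl
  φ^-φ·-comm (suc n) p = cong φ·_ (φ^-φ·-comm n p)

  φ^-0ᵠ : ∀ n → φ^ n · 0ᵠ ≡ 0ᵠ
  φ^-0ᵠ zero    = refl
  φ^-0ᵠ (suc n) = cong φ·_ (φ^-0ᵠ n)

  φ·δ-swap : ∀ m r → φ· δ (+ (m ℕ.+ r)) m ≡ -ᵠ δ (+ m) r
  φ·δ-swap m r = cong₂ ⟨_,_⟩ (sym (ℤ.neg-involutive (+ m))) (cancel (+ m) (+ r))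
    where cancel : ∀ M R → - (M + R) + M ≡ - R
          cancel = solve-∀

  -- Since φⁿ(a + bφ) = (Fₙ₋₁a + Fₙb) + (Fₙa + Fₙ₊₁b)φ and Fₙ₊₁/Fₙ → φ, a + bφ > 0 iff
  -- some φⁿ(a + bφ) has a nonnegative and a positive coordinate.
  data Manifest : ℤ[φ] → Set where
    manifest : ∀ a b → Manifest ⟨ + a , + suc b ⟩

  Positive : ℤ[φ] → Set
  Positive p = Σ ℕ λ n → Manifest (φ^ n · p)

  NonNegative : ℤ[φ] → Set
  NonNegative p = Positive p ⊎ p ≡ 0ᵠ

  manifest-φ· : ∀ {p} → Manifest p → Manifest (φ· p)
  manifest-φ· (manifest a b) =
    subst (λ n → Manifest ⟨ + suc b , + n ⟩) (sym (ℕ.+-suc a b)) (manifest (suc b) (a ℕ.+ b))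

  manifest-φ^ : ∀ k {n p} → Manifest (φ^ n · p) → Manifest (φ^ (k ℕ.+ n) · p)
  manifest-φ^ zero    m = m
  manifest-φ^ (suc k) m = manifest-φ· (manifest-φ^ k m)

  manifest-+ᵠ : ∀ {p q} → Manifest p → Manifest q → Manifest (p +ᵠ q)
  manifest-+ᵠ (manifest a b) (manifest c d) = manifest (a ℕ.+ c) (b ℕ.+ suc d)

  manifest⇒¬manifest-neg : ∀ {p} → Manifest p → ¬ Manifest (-ᵠ p)
  manifest⇒¬manifest-neg (manifest a b) ()

  manifest-align : ∀ {m n p q} → Manifest (φ^ m · p) → Manifest (φ^ n · q) →
                    Manifest (φ^ (n ℕ.+ m) · p) × Manifest (φ^ (n ℕ.+ m) · q)
  manifest-align {m} {n} {q = q} mp mq =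
    manifest-φ^ n mp , subst (λ k → Manifest (φ^ k · q)) (ℕ.+-comm m n) (manifest-φ^ m mq)

  positive-+ᵠ : ∀ {p q} → Positive p → Positive q → Positive (p +ᵠ q)
  positive-+ᵠ {p} {q} (m , mp) (n , mq) with manifest-align {m} {n} {p} {q} mp mq
  ... | mp′ , mq′ = n ℕ.+ m , subst Manifest (sym (φ^-distrib-+ᵠ (n ℕ.+ m) p q)) (manifest-+ᵠ mp′ mq′)

  positive⇒¬positive-neg : ∀ {p} → Positive p → ¬ Positive (-ᵠ p)
  positive⇒¬positive-neg {p} (m , mp) (n , mq) with manifest-align {m} {n} {p} { -ᵠ p } mp mq
  ... | mp′ , mq′ = manifest⇒¬manifest-neg mp′ (subst Manifest (φ^-neg-comm (n ℕ.+ m) p) mq′)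

  positive-integer : ∀ n → Positive ⟨ + suc n , + 0 ⟩
  positive-integer n = 1 , subst (λ y → Manifest ⟨ + 0 , + y ⟩) (sym (ℕ.+-identityʳ (suc n))) (manifest 0 n)

  ¬positive-0ᵠ : ¬ Positive 0ᵠ
  ¬positive-0ᵠ (n , m) with subst Manifest (φ^-0ᵠ n) m
  ... | ()

  positive-φ· : ∀ {p} → Positive p → Positive (φ· p)
  positive-φ· {p} (n , m) = n , subst Manifest (sym (φ^-φ·-comm n p)) (manifest-φ· m)

  φ·-reflects-positive : ∀ {p} → Positive (φ· p) → Positive p
  φ·-reflects-positive {p} (n , m) = suc n , subst Manifest (φ^-φ·-comm n p) m

  δ-positive-< : ∀ {a b} → a ℕ.< b → Positive (δ (+ suc a) (suc b))
  δ-positive-< {a} a<b with ℕ.m≤n⇒∃[o]m+o≡n a<b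
  ... | d , refl = 1 , subst (λ y → Manifest ⟨ + suc (suc a ℕ.+ d) , y ⟩) (cancel (+ a) (+ d)) (manifest _ d)
    where cancel : ∀ A D → + 1 + D ≡ - (+ 1 + A) + (+ 1 + (+ 1 + A + D))
          cancel = solve-∀

  δ-positive-diagonal : ∀ a → Positive (δ (+ suc a) (suc a))
  δ-positive-diagonal a = 2 , subst₂ (λ x y → Manifest ⟨ x , y ⟩) (cancel₁ (+ a)) (cancel₂ (+ a)) (manifest 0 a)
    where cancel₁ : ∀ A → + 0 ≡ - (+ 1 + A) + (+ 1 + A)
          cancel₁ = solve-∀
          cancel₂ : ∀ A → + 1 + A ≡ (+ 1 + A) + (- (+ 1 + A) + (+ 1 + A))
          cancel₂ = solve-∀

  δ-positive-≤ : ∀ {k m} → k ℕ.≤ m → 1 ℕ.≤ m → Positive (δ (+ k) m)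
  δ-positive-≤ {zero}  {suc m} _ _ = 0 , manifest 0 m
  δ-positive-≤ {suc k} (s≤s k≤m) _ with ℕ.m≤n⇒m<n∨m≡n k≤m
  ... | inj₁ k<m  = δ-positive-< k<m
  ... | inj₂ refl = δ-positive-diagonal k

  -- Euclid's algorithm on the coefficients; the fuel bounds a.
  δ-positive-or-negative′ : ∀ fuel a b → a ℕ.< fuel →
                           Positive (δ (+ suc a) (suc b)) ⊎ Positive (-ᵠ δ (+ suc a) (suc b))
  δ-positive-or-negative′ (suc fuel) a b (s≤s a≤fuel) with ℕ.<-cmp a b
  ... | tri< a<b _ _  = inj₁ (δ-positive-< a<b)
  ... | tri≈ _ refl _ = inj₁ (δ-positive-diagonal a)
  ... | tri> _ _ b<a with ℕ.m≤n⇒∃[o]m+o≡n b<a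
  ...   | d , refl with δ-positive-or-negative′ fuel b d (ℕ.<-≤-trans (ℕ.m≤m+n (suc b) d) a≤fuel)
  ...     | inj₁ P = inj₂ (φ·-reflects-positive (subst Positive (cong ⟨ _ ,_⟩ (cancel (+ b) (+ d))) P))
    where cancel : ∀ B D → + 1 + D ≡ (+ 1 + (+ 1 + B + D)) + - (+ 1 + B)
          cancel = solve-∀
  ...     | inj₂ P = inj₁ (φ·-reflects-positive (subst Positive (cong ⟨ _ ,_⟩ (cancel (+ b) (+ d))) P))
    where cancel : ∀ B D → - (+ 1 + D) ≡ - (+ 1 + (+ 1 + B + D)) + (+ 1 + B)
          cancel = solve-∀

  δ-positive-or-negative : ∀ a b → Positive (δ (+ suc a) (suc b)) ⊎ Positive (-ᵠ δ (+ suc a) (suc b))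
  δ-positive-or-negative a b = δ-positive-or-negative′ (suc a) a b ℕ.≤-refl

  trichotomy : ∀ p → Positive p ⊎ p ≡ 0ᵠ ⊎ Positive (-ᵠ p)
  trichotomy ⟨ + a      , + suc b  ⟩ = inj₁ (0 , manifest a b)
  trichotomy ⟨ + suc a  , + zero   ⟩ = inj₁ (positive-integer a)
  trichotomy ⟨ + zero   , + zero   ⟩ = inj₂ (inj₁ refl)
  trichotomy ⟨ -[1+ a ] , -[1+ b ] ⟩ = inj₂ (inj₂ (0 , manifest (suc a) b))
  trichotomy ⟨ -[1+ a ] , + zero   ⟩ = inj₂ (inj₂ (positive-integer a))
  trichotomy ⟨ + zero   , -[1+ b ] ⟩ = inj₂ (inj₂ (0 , manifest 0 b))
  trichotomy ⟨ -[1+ a ] , + suc b  ⟩ with δ-positive-or-negative a b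
  ... | inj₁ P = inj₁ P
  ... | inj₂ N = inj₂ (inj₂ N)
  trichotomy ⟨ + suc a  , -[1+ b ] ⟩ with δ-positive-or-negative a b
  ... | inj₁ N = inj₂ (inj₂ N)
  ... | inj₂ P = inj₁ P

  positive-φ-1 : Positive (δ (+ 1) 1)
  positive-φ-1 = δ-positive-diagonal 0

  positive-2-φ : Positive (-ᵠ δ (+ 2) 1)
  positive-2-φ = 3 , manifest 0 0

  positive-integer-inv : ∀ z → Positive ⟨ z , + 0 ⟩ → Σ ℕ λ n → z ≡ + suc n
  positive-integer-inv (+ suc n) _ = n , refl
  positive-integer-inv (+ zero)  P = ⊥-elim (¬positive-0ᵠ P)
  positive-integer-inv -[1+ n ]  P = ⊥-elim (positive⇒¬positive-neg P (positive-integer n))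

  nonNegative-integer : ∀ n → NonNegative ⟨ + n , + 0 ⟩
  nonNegative-integer zero    = inj₂ refl
  nonNegative-integer (suc n) = inj₁ (positive-integer n)

  nonNegative-δ-diagonal : ∀ n → NonNegative (δ (+ n) n)
  nonNegative-δ-diagonal zero    = inj₂ refl
  nonNegative-δ-diagonal (suc n) = inj₁ (δ-positive-≤ ℕ.≤-refl (s≤s z≤n))

  nonNegative+positive : ∀ {p q} → NonNegative p → Positive q → Positive (p +ᵠ q)
  nonNegative+positive     (inj₁ P)    Q = positive-+ᵠ P Q
  nonNegative+positive {q = q} (inj₂ refl) Q = subst Positive (sym (+ᵠ-identityˡ q)) Q

  positive+nonNegative : ∀ {p q} → Positive p → NonNegative q → Positive (p +ᵠ q)
  positive+nonNegative     P (inj₁ Q)    = positive-+ᵠ P Q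
  positive+nonNegative {p} P (inj₂ refl) = subst Positive (sym (+ᵠ-identityʳ p)) P

  nonNegative-+ᵠ : ∀ {p q} → NonNegative p → NonNegative q → NonNegative (p +ᵠ q)
  nonNegative-+ᵠ     (inj₁ P)    Q = inj₁ (positive+nonNegative P Q)
  nonNegative-+ᵠ {q = q} (inj₂ refl) Q = subst NonNegative (sym (+ᵠ-identityˡ q)) Q

  nonNegative∧≢0⇒positive : ∀ {p} → NonNegative p → p ≢ 0ᵠ → Positive p
  nonNegative∧≢0⇒positive (inj₁ P) _   = P
  nonNegative∧≢0⇒positive (inj₂ e) p≢0 = ⊥-elim (p≢0 e)

  ¬positive⇒positive-neg : ∀ {p} → p ≢ 0ᵠ → ¬ Positive p → Positive (-ᵠ p)
  ¬positive⇒positive-neg {p} p≢0 ¬P with trichotomy p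
  ... | inj₁ P        = ⊥-elim (¬P P)
  ... | inj₂ (inj₁ e) = ⊥-elim (p≢0 e)
  ... | inj₂ (inj₂ N) = N

  nonNegative⊎negative : ∀ p → NonNegative p ⊎ Positive (-ᵠ p)
  nonNegative⊎negative p with trichotomy p
  ... | inj₁ P        = inj₁ (inj₁ P)
  ... | inj₂ (inj₁ e) = inj₁ (inj₂ e)
  ... | inj₂ (inj₂ N) = inj₂ N

  ⟨⟩-injectiveʳ : ∀ {a b c d} → ⟨ a , b ⟩ ≡ ⟨ c , d ⟩ → b ≡ d
  ⟨⟩-injectiveʳ refl = refl

module GoldenComparison where

  open GoldenIntegers
  open import Data.Nat
  open import Data.Nat.Properties
  open import Data.Nat.Divisibility using (_∣_; divides)
  open import Data.Nat.Primality using (Prime; prime?; euclidsLemma)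
  open import Data.Nat.Tactic.RingSolver using (solve-∀)
  open import Data.Integer using (+_)
  open import Data.Bool using (true; false; not; _∨_)
  open import Data.Bool.Properties using (∨-zeroʳ)
  open import Data.Product using (∃; _,_; _×_)
  open import Data.Sum using (_⊎_; inj₂; reduce; [_,_])
  open import Data.Empty using (⊥-elim)
  open import Function using (_∘_; id)
  open import Function.Bundles using (_⇔_; mk⇔; Equivalence)
  import Function.Properties.Equivalence as ⇔
  open import Relation.Nullary using (¬_; Dec; yes; no)
  open import Relation.Nullary.Negation using (contraposition)
  open import Relation.Nullary.Decidable using (toWitness; dec-true; dec-false)
  open import Relation.Binary using (tri<; tri≈; tri>)
  open import Relation.Binary.PropositionalEquality hiding ([_])

  5-prime : Prime 5
  5-prime = toWitness {a? = prime? 5} _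

  5∣t²⇒5∣t : ∀ t → 5 ∣ t * t → 5 ∣ t
  5∣t²⇒5∣t t = reduce ∘ euclidsLemma t t 5-prime

  √5-descent : ∀ {r} t → t * t ≡ 5 * (r * r) → ∃ λ q → t ≡ q * 5 × r * r ≡ 5 * (q * q)
  √5-descent {r} t t²≡5r² with 5∣t²⇒5∣t t (divides (r * r) (trans t²≡5r² (*-comm 5 (r * r))))
  ... | divides q refl = q , refl , *-cancelˡ-≡ _ _ 5 (trans (sym t²≡5r²) (square-5q q))
    where
    square-5q : ∀ q → q * 5 * (q * 5) ≡ 5 * (5 * (q * q))
    square-5q = solve-∀

  √5-irrational′ : ∀ fuel {r} t → r < fuel → t * t ≡ 5 * (r * r) → r ≡ 0
  √5-irrational′ _          {zero}  _ _ _ = refl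
  √5-irrational′ (suc fuel) {suc r} t (s≤s r<fuel) t²≡5r² with √5-descent {suc r} t t²≡5r²
  ... | q , _ , r²≡5q² with √5-descent {q} (suc r) r²≡5q²
  ...   | zero  , () , _
  ...   | suc s , r≡s*5 , q²≡5s² = trans r≡s*5 (cong (_* 5) (√5-irrational′ fuel {suc s} q s<fuel q²≡5s²))
    where s<fuel = ≤-trans (subst (suc s <_) (sym r≡s*5) (m<m*n (suc s) 5 (s≤s (s≤s z≤n)))) r<fuel

  √5-irrational : ∀ r t → t * t ≡ 5 * (r * r) → r ≡ 0
  √5-irrational r t = √5-irrational′ (suc r) {r} t ≤-refl

  <ᵇ-complement : ∀ {a b c d} → a + b ≡ c + d → b ≢ d → (a <ᵇ c) ≡ not (b <ᵇ d)
  <ᵇ-complement {a} {b} {c} {d} eq b≢d with <-cmp a c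
  ... | tri< a<c _ _ = trans (dec-true (a <? c) a<c) (cong not (sym (dec-false (b <? d) (<⇒≯ d<b))))
    where d<b = +-cancelˡ-< c d b (subst (_< c + b) eq (+-monoˡ-< b a<c))
  ... | tri≈ _ refl _ = ⊥-elim (b≢d (+-cancelˡ-≡ a b d eq))
  ... | tri> _ _ c<a = trans (dec-false (a <? c) (<⇒≯ c<a)) (cong not (sym (dec-true (b <? d) b<d)))
    where b<d = +-cancelˡ-< c b d (subst (c + b <_) eq (+-monoˡ-< b c<a))

  ltφ-below : ∀ {k m} → k ≤ m → 1 ≤ m → ltφ k m ≡ true
  ltφ-below {k} {suc m} k≤m _ = trans (cong ((k + k ≤ᵇ suc m) ∨_) (dec-true (_ <? _) x²<5m²)) (∨-zeroʳ _)
    where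
    x = k + k ∸ suc m
    x≤m : x ≤ suc m
    x≤m = ≤-trans (∸-monoˡ-≤ (suc m) (+-mono-≤ k≤m k≤m)) (≤-reflexive (m+n∸n≡m (suc m) (suc m)))
    x²<5m² : x * x < 5 * (suc m * suc m)
    x²<5m² = ≤-<-trans (*-mono-≤ x≤m x≤m) (m<m+n (suc m * suc m) (s≤s z≤n))

  -- With 2m = t + r, multiplying by 4 removes the halving.
  sum-of-squares : ∀ m r t → t + r ≡ m + m →
                   (m + r + r) * (m + r + r) + t * t ≡ 5 * (m * m) + 5 * (r * r)
  sum-of-squares m r t t+r≡2m = *-cancelˡ-≡ _ _ 4 (begin
    4 * ((m + r + r) * (m + r + r) + t * t)         ≡⟨ expand₁ m r t ⟩
    ((m + m) + 4 * r) * ((m + m) + 4 * r) + 4 * (t * t) ≡⟨ cong (λ z → (z + 4 * r) * (z + 4 * r) + 4 * (t * t)) (sym t+r≡2m) ⟩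
    (t + r + 4 * r) * (t + r + 4 * r) + 4 * (t * t)   ≡⟨ expand₂ t r ⟩
    5 * ((t + r) * (t + r)) + 4 * (5 * (r * r))       ≡⟨ cong (λ z → 5 * (z * z) + 4 * (5 * (r * r))) t+r≡2m ⟩
    5 * ((m + m) * (m + m)) + 4 * (5 * (r * r))       ≡⟨ expand₃ m r ⟩
    4 * (5 * (m * m) + 5 * (r * r))                   ∎)
    where
    open ≡-Reasoning
    expand₁ : ∀ m r t → 4 * ((m + r + r) * (m + r + r) + t * t) ≡ ((m + m) + 4 * r) * ((m + m) + 4 * r) + 4 * (t * t)
    expand₁ = solve-∀
    expand₂ : ∀ t r → (t + r + 4 * r) * (t + r + 4 * r) + 4 * (t * t) ≡ 5 * ((t + r) * (t + r)) + 4 * (5 * (r * r))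
    expand₂ = solve-∀
    expand₃ : ∀ m r → 5 * ((m + m) * (m + m)) + 4 * (5 * (r * r)) ≡ 4 * (5 * (m * m) + 5 * (r * r))
    expand₃ = solve-∀

  -- (m + r) < mφ ⇔ r < m/φ ⇔ ¬ (m < rφ).  In the squared form of ltφ: the left side is
  -- (m + 2r)² < 5m², the right one (2m − r)² < 5r² when r < 2m, and these are complementary
  -- since (m + 2r)² + (2m − r)² = 5m² + 5r² while (2m − r)² ≠ 5r² by irrationality.
  ltφ-step : ∀ m r → 1 ≤ r → ltφ (m + r) m ≡ not (ltφ m r)
  ltφ-step m r 1≤r = trans lhs (rhs (m + m ≤? r))
    where
    y = m + r + r
    2[m+r]≰m : ¬ (m + r + (m + r) ≤ m)
    2[m+r]≰m = <⇒≱ (<-≤-trans (m<m+n m 1≤r) (m≤m+n (m + r) (m + r)))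
    2[m+r]∸m≡y : m + r + (m + r) ∸ m ≡ y
    2[m+r]∸m≡y = trans (cong (_∸ m) (shuffle m r)) (m+n∸m≡n m y)
      where shuffle : ∀ m r → m + r + (m + r) ≡ m + (m + r + r)
            shuffle = solve-∀
    lhs : ltφ (m + r) m ≡ (y * y <ᵇ 5 * (m * m))
    lhs = cong₂ _∨_ (dec-false (_ ≤? m) 2[m+r]≰m) (cong (λ x → x * x <ᵇ 5 * (m * m)) 2[m+r]∸m≡y)
    t = m + m ∸ r
    rhs : Dec (m + m ≤ r) → (y * y <ᵇ 5 * (m * m)) ≡ not (ltφ m r)
    rhs (yes 2m≤r) = trans (dec-false (_ <? _) (≤⇒≯ 5m²≤y²))
                           (cong (λ b → not (b ∨ (t * t <ᵇ 5 * (r * r)))) (sym (dec-true (_ ≤? r) 2m≤r)))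
      where
      5m≤y : 5 * m ≤ y
      5m≤y = subst (_≤ y) (sym (five m)) (+-mono-≤ (+-monoʳ-≤ m 2m≤r) 2m≤r)
        where five : ∀ m → 5 * m ≡ m + (m + m) + (m + m)
              five = solve-∀
      5m²≤y² : 5 * (m * m) ≤ y * y
      5m²≤y² = subst (_≤ y * y) (*-assoc 5 m m) (*-mono-≤ 5m≤y (≤-trans (m≤m+n m r) (m≤m+n (m + r) r)))
    rhs (no 2m≰r) = trans (<ᵇ-complement {y * y} {t * t} {5 * (m * m)} {5 * (r * r)}
                                         (sum-of-squares m r t t+r≡2m) t²≢5r²)
                          (cong (λ b → not (b ∨ (t * t <ᵇ 5 * (r * r)))) (sym (dec-false (_ ≤? r) 2m≰r)))
      where
      t+r≡2m : t + r ≡ m + m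
      t+r≡2m = m∸n+n≡m (<⇒≤ (≰⇒> 2m≰r))
      t²≢5r² : t * t ≢ 5 * (r * r)
      t²≢5r² eq = <⇒≢ 1≤r (sym (√5-irrational r t eq))

  not≡true⇔≢true : ∀ b → not b ≡ true ⇔ (b ≢ true)
  not≡true⇔≢true true  = mk⇔ (λ ()) (λ b≢true → ⊥-elim (b≢true refl))
  not≡true⇔≢true false = mk⇔ (λ _ ()) (λ _ → refl)

  ¬-⇔ : ∀ {a b} {A : Set a} {B : Set b} → A ⇔ B → (¬ A) ⇔ (¬ B)
  ¬-⇔ A⇔B = mk⇔ (contraposition (Equivalence.from A⇔B)) (contraposition (Equivalence.to A⇔B))

  positive-δ-step : ∀ m r → 1 ≤ r → Positive (δ (+ (m + r)) m) ⇔ (¬ Positive (δ (+ m) r))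
  positive-δ-step m (suc r) _ = mk⇔
    (λ P Q → positive⇒¬positive-neg Q (subst Positive (φ·δ-swap m (suc r)) (positive-φ· P)))
    (λ ¬Q → φ·-reflects-positive (subst Positive (sym (φ·δ-swap m (suc r))) (¬positive⇒positive-neg (λ ()) ¬Q)))

  -- Recursion along the continued fraction expansion of φ; the fuel bounds k.
  ltφ⇔positive′ : ∀ fuel k m → k < fuel → 1 ≤ k ⊎ 1 ≤ m → ltφ k m ≡ true ⇔ Positive (δ (+ k) m)
  ltφ⇔positive′ (suc fuel) k m (s≤s k≤fuel) k⊎m≢0 with k ≤? m
  ... | yes k≤m = mk⇔ (λ _ → δ-positive-≤ k≤m 1≤m) (λ _ → ltφ-below k≤m 1≤m)
    where 1≤m = [ (λ 1≤k → ≤-trans 1≤k k≤m) , id ] k⊎m≢0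
  ... | no k≰m = subst (λ k → ltφ k m ≡ true ⇔ Positive (δ (+ k) m)) (m+[n∸m]≡n (<⇒≤ m<k)) step
    where
    m<k = ≰⇒> k≰m
    r = k ∸ m
    1≤r = m<n⇒0<n∸m m<k
    step : ltφ (m + r) m ≡ true ⇔ Positive (δ (+ (m + r)) m)
    step = ⇔.trans (subst (λ b → b ≡ true ⇔ (ltφ m r ≢ true)) (sym (ltφ-step m r 1≤r)) (not≡true⇔≢true (ltφ m r)))
          (⇔.trans (¬-⇔ (ltφ⇔positive′ fuel m r (<-≤-trans m<k k≤fuel) (inj₂ 1≤r)))
                   (⇔.sym (positive-δ-step m r 1≤r)))

  ltφ⇔positive : ∀ k m → 1 ≤ k ⊎ 1 ≤ m → ltφ k m ≡ true ⇔ Positive (δ (+ k) m)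
  ltφ⇔positive k m = ltφ⇔positive′ (suc k) k m ≤-refl

module GoldenFloor where

  open GoldenIntegers
  open GoldenComparison using (ltφ⇔positive)
  open import Data.Nat as ℕ using (ℕ; zero; suc; z≤n; s≤s)
  import Data.Nat.Properties as ℕ
  open import Data.Integer using (ℤ; +_; -[1+_]; _+_; -_; _-_)
  import Data.Integer.Properties as ℤ
  open import Data.Integer.Tactic.RingSolver using (solve-∀)
  open import Data.Bool using (Bool; true; false)
  open import Data.List using (length; filterᵇ; applyUpTo)
  import Data.List.Properties as List
  open import Data.Product using (Σ; _,_; _×_; proj₁; proj₂)
  open import Data.Sum using (inj₁; inj₂)
  open import Function using (_∘_)
  open import Function.Bundles using (Equivalence)
  open import Data.Empty using (⊥-elim)
  open import Relation.Binary.PropositionalEquality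

  IsFloor : ℕ → ℤ → Set
  IsFloor m a = NonNegative (δ a m) × Positive (-ᵠ δ (+ 1 + a) m)

  neg-1+ : ∀ a → - a + - + 1 ≡ - (+ 1 + a)
  neg-1+ a = trans (ℤ.+-comm (- a) _) (sym (ℤ.neg-distrib-+ (+ 1) a))

  -- ⌊(m + 1)φ⌋ is ⌊mφ⌋ + 1 or ⌊mφ⌋ + 2, since 1 < φ < 2.
  floor-exists : ∀ m → Σ ℕ λ a → a ℕ.≤ m ℕ.+ m × IsFloor m (+ a)
  floor-exists zero = 0 , z≤n , inj₂ refl , positive-integer 0
  floor-exists (suc m) with floor-exists m
  ... | a , a≤2m , lower , upper with nonNegative⊎negative (δ (+ (2 ℕ.+ a)) (suc m))
  ...   | inj₁ lower′ = 2 ℕ.+ a , s≤s (ℕ.≤-trans (s≤s a≤2m) (ℕ.≤-reflexive (sym (ℕ.+-suc m m)))) , lower′ ,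
                        subst Positive (cong₂ ⟨_,_⟩ (add-two (+ a)) (neg-1+ (+ m))) (positive-+ᵠ upper positive-2-φ)
    where add-two : ∀ A → (+ 1 + A) + + 2 ≡ + 1 + (+ 1 + (+ 1 + A))
          add-two = solve-∀
  ...   | inj₂ upper′ = suc a , s≤s (ℕ.≤-trans a≤2m (ℕ.+-monoʳ-≤ m (ℕ.n≤1+n m))) ,
                        inj₁ (subst Positive (cong₂ ⟨_,_⟩ (neg-1+ (+ a)) (ℤ.+-comm (+ m) (+ 1)))
                                    (nonNegative+positive lower positive-φ-1)) ,
                        upper′

  length-filterᵇ-threshold : ∀ {A : Set} (p : A → Bool) (f : ℕ → A) n c → c ℕ.≤ n →
                             (∀ i → i ℕ.< c → p (f i) ≡ true) →
                             (∀ i → c ℕ.≤ i → i ℕ.< n → p (f i) ≡ false) →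
                             length (filterᵇ p (applyUpTo f n)) ≡ c
  length-filterᵇ-threshold p f zero    zero    _         _      _       = refl
  length-filterᵇ-threshold p f (suc n) zero    _         _      outside rewrite outside 0 z≤n (s≤s z≤n) =
    length-filterᵇ-threshold p (f ∘ suc) n 0 z≤n (λ _ ()) (λ i _ i<n → outside (suc i) z≤n (s≤s i<n))
  length-filterᵇ-threshold p f (suc n) (suc c) (s≤s c≤n) inside outside rewrite inside 0 (s≤s z≤n) =
    cong suc (length-filterᵇ-threshold p (f ∘ suc) n c c≤n (λ i i<c → inside (suc i) (s≤s i<c))
                                         (λ i c≤i i<n → outside (suc i) (s≤s c≤i) (s≤s i<n)))

  h-isFloor : ∀ m → IsFloor m (+ h m)
  h-isFloor m with floor-exists m
  ... | a , a≤2m , isFloor@(lower , upper) = subst (λ z → IsFloor m (+ z)) (sym h≡a) isFloor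
    where
    below : ∀ i → i ℕ.< a → ltφ (suc i) m ≡ true
    below i i<a with ℕ.m≤n⇒∃[o]m+o≡n i<a
    ... | d , refl = Equivalence.from (ltφ⇔positive (suc i) m (inj₁ (s≤s z≤n)))
                       (nonNegative∧≢0⇒positive (subst NonNegative split (nonNegative-+ᵠ lower (nonNegative-integer d)))
                                                (λ ()))
      where
      cancel : ∀ I D → - (+ 1 + I + D) + D ≡ - (+ 1 + I)
      cancel = solve-∀
      split : δ (+ (suc i ℕ.+ d)) m +ᵠ ⟨ + d , + 0 ⟩ ≡ δ (+ suc i) m
      split = cong₂ ⟨_,_⟩ (cancel (+ i) (+ d)) (ℤ.+-identityʳ (+ m))
    above : ∀ i → a ℕ.≤ i → i ℕ.< m ℕ.+ m → ltφ (suc i) m ≡ false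
    above i a≤i _ with ltφ (suc i) m in lt | ℕ.m≤n⇒∃[o]m+o≡n a≤i
    ... | false | _      = refl
    ... | true  | d , refl = ⊥-elim (positive⇒¬positive-neg
          (Equivalence.to (ltφ⇔positive (suc i) m (inj₁ (s≤s z≤n))) lt)
          (subst Positive (cong ⟨ _ ,_⟩ (ℤ.+-identityʳ (- + m))) (positive+nonNegative upper (nonNegative-integer d))))
    h≡a : h m ≡ a
    h≡a = trans (cong (λ l → length (filterᵇ (λ k → ltφ k m) l)) (List.map-upTo suc (m ℕ.+ m)))
                (length-filterᵇ-threshold _ suc (m ℕ.+ m) a a≤2m below above)

  floor-≥ : ∀ {m a b} → IsFloor m a → IsFloor m b → Σ ℕ λ n → a - b ≡ + n
  floor-≥ {m} {a} {b} (_ , upper-a) (lower-b , _)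
    with positive-integer-inv _ (subst Positive (cong ⟨ _ ,_⟩ (ℤ.+-inverseˡ (+ m))) (positive+nonNegative upper-a lower-b))
  ... | n , gap≡1+n = n , (begin
    a - b                        ≡⟨ drop-one a b ⟩
    (- - (+ 1 + a) + - b) - + 1  ≡⟨ cong (_- + 1) gap≡1+n ⟩
    (+ 1 + + n) - + 1            ≡⟨ cancel (+ n) ⟩
    + n                          ∎)
    where
    open ≡-Reasoning
    drop-one : ∀ a b → a - b ≡ (- - (+ 1 + a) + - b) - + 1
    drop-one = solve-∀
    cancel : ∀ N → (+ 1 + N) - + 1 ≡ N
    cancel = solve-∀

  floor-unique : ∀ {m a b} → IsFloor m a → IsFloor m b → a ≡ b
  floor-unique {a = a} {b} Fa Fb with floor-≥ Fa Fb | floor-≥ Fb Fa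
  ... | _ , _     | zero  , b-a≡0     = sym (ℤ.i-j≡0⇒i≡j b a b-a≡0)
  ... | _ , a-b≡n | suc _ , b-a≡1+n′ = ⊥-elim (nonneg≢neg (trans (sym a-b≡n) (trans (swap a b) (cong -_ b-a≡1+n′))))
    where
    swap : ∀ a b → a - b ≡ - (b - a)
    swap = solve-∀
    nonneg≢neg : ∀ {n k} → + n ≢ -[1+ k ]
    nonneg≢neg ()

  -- ⌊(m + 1)φ⌋ > ⌊mφ⌋ because (m + 1)φ − mφ = φ > 1.
  h-increasing : ∀ m → Σ ℕ λ q → h (suc m) ≡ h m ℕ.+ suc q
  h-increasing m = proj₁ gap , ℤ.+-injective (trans (sym (split a b)) (cong (λ z → a + z) (proj₂ gap)))
    where
    a = + h m
    b = + h (suc m)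
    first : ∀ B A → (+ 1 + B + - A) + - + 1 ≡ B - A
    first = solve-∀
    second : ∀ M → (- (+ 1 + M) + M) + + 1 ≡ + 0
    second = solve-∀
    split : ∀ A B → A + (B - A) ≡ B
    split = solve-∀
    gap : Σ ℕ λ q → b - a ≡ + suc q
    gap = positive-integer-inv _ (subst Positive (cong₂ ⟨_,_⟩ (first b a) (second (+ m)))
            (positive-+ᵠ (positive+nonNegative (proj₂ (h-isFloor (suc m))) (proj₁ (h-isFloor m))) positive-φ-1))

module BestApproximation where

  open GoldenIntegers
  open import Data.Nat as ℕ using (ℕ; zero; suc; z≤n; s≤s)
  import Data.Nat.Properties as ℕ
  open import Data.Integer using (+_; _+_; -_; _-_)
  import Data.Integer.Properties as ℤ
  open import Data.Integer.Tactic.RingSolver using (solve-∀)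
  open import Data.Product using (_,_; proj₂)
  open import Relation.Nullary using (yes; no)
  open import Data.Sum using (inj₁; inj₂)
  open import Data.Empty using (⊥-elim)
  open import Function using (_∘_)
  open import Relation.Binary.PropositionalEquality

  fib : ℕ → ℕ
  fib zero          = 0
  fib (suc zero)    = 1
  fib (suc (suc n)) = fib (suc n) ℕ.+ fib n

  fib-positive : ∀ n → 1 ℕ.≤ fib (suc n)
  fib-positive zero    = s≤s z≤n
  fib-positive (suc n) = ℕ.≤-trans (fib-positive n) (ℕ.m≤m+n (fib (suc n)) (fib n))

  fib-≥ : ∀ n → suc n ℕ.≤ fib (suc (suc n))
  fib-≥ zero    = s≤s z≤n
  fib-≥ (suc n) = subst (ℕ._≤ fib (suc (suc (suc n)))) (ℕ.+-comm (suc n) 1) (ℕ.+-mono-≤ (fib-≥ n) (fib-positive n))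

  -- ε n = Fₙφ − Fₙ₊₁, the error of the n-th convergent of φ.
  ε : ℕ → ℤ[φ]
  ε n = δ (+ fib (suc n)) (fib n)

  -- signed n p = (−1)ⁿ⁺¹p, which is positive iff p has the sign of ε n.
  signed : ℕ → ℤ[φ] → ℤ[φ]
  signed zero          p = -ᵠ p
  signed (suc zero)    p = p
  signed (suc (suc n)) p = signed n p

  signed-suc : ∀ n p → signed (suc n) p ≡ -ᵠ signed n p
  signed-suc zero          p = sym (-ᵠ-involutive p)
  signed-suc (suc zero)    p = refl
  signed-suc (suc (suc n)) p = signed-suc n p

  signed-neg-comm : ∀ n p → signed n (-ᵠ p) ≡ -ᵠ signed n p
  signed-neg-comm zero          p = refl
  signed-neg-comm (suc zero)    p = refl
  signed-neg-comm (suc (suc n)) p = signed-neg-comm n p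

  signed-φ· : ∀ n p → signed n (φ· p) ≡ φ· signed n p
  signed-φ· zero          p = sym (φ·-neg-comm p)
  signed-φ· (suc zero)    p = refl
  signed-φ· (suc (suc n)) p = signed-φ· n p

  φ·-signed-suc : ∀ n p → φ· signed (suc n) p ≡ signed n (-ᵠ φ· p)
  φ·-signed-suc n p = begin
    φ· signed (suc n) p    ≡⟨ cong φ·_ (signed-suc n p) ⟩
    φ· (-ᵠ signed n p)     ≡⟨ φ·-neg-comm (signed n p) ⟩
    -ᵠ φ· signed n p       ≡⟨ cong -ᵠ_ (sym (signed-φ· n p)) ⟩
    -ᵠ signed n (φ· p)     ≡⟨ sym (signed-neg-comm n (φ· p)) ⟩
    signed n (-ᵠ φ· p)     ∎
    where open ≡-Reasoning

  φ·-reflects-signed : ∀ n {p q} → signed n q ≡ signed n (-ᵠ φ· p) →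
                       Positive (signed n q) → Positive (signed (suc n) p)
  φ·-reflects-signed n {p} eq P =
    φ·-reflects-positive (subst Positive (trans eq (sym (φ·-signed-suc n p))) P)

  φ·-ε : ∀ n → φ· ε (suc n) ≡ -ᵠ ε n
  φ·-ε n = cong₂ ⟨_,_⟩ (sym (ℤ.neg-involutive (+ fib (suc n)))) (cancel (+ fib (suc n)) (+ fib n))
    where cancel : ∀ A B → - (A + B) + A ≡ - B
          cancel = solve-∀

  ε-sign : ∀ n → Positive (signed n (ε n))
  ε-sign zero    = positive-integer 0
  ε-sign (suc n) = φ·-reflects-signed n (cong (signed n) (sym ε-eq)) (ε-sign n)
    where ε-eq : -ᵠ φ· ε (suc n) ≡ ε n
          ε-eq = trans (cong -ᵠ_ (φ·-ε n)) (-ᵠ-involutive (ε n))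

  ε-recurrence : ∀ n p → p -ᵠ ε (suc (suc n)) ≡ (p -ᵠ ε n) -ᵠ ε (suc n)
  ε-recurrence n ⟨ x , y ⟩ = cong₂ ⟨_,_⟩ (first x (+ fib n) (+ fib (suc n))) (second y (+ fib n) (+ fib (suc n)))
    where
    first : ∀ x A B → x + - - ((B + A) + B) ≡ (x + - - B) + - - (B + A)
    first = solve-∀
    second : ∀ y A B → y + - (B + A) ≡ (y + - A) + - B
    second = solve-∀

  data Parity (n : ℕ) : Set where
    odd  : (∀ p → signed n p ≡ p) → NonNegative (ε 1 -ᵠ ε n) → Parity n
    even : (∀ p → signed n p ≡ -ᵠ p) → Parity n

  parity : ∀ n → Parity n
  parity zero          = even λ _ → refl
  parity (suc zero)    = odd (λ _ → refl) (inj₂ refl)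
  parity (suc (suc n)) with parity n
  ... | even neg      = even neg
  ... | odd id ε≤ε₁   = odd id (subst NonNegative (sym (ε-recurrence n (ε 1))) (nonNegative-+ᵠ ε≤ε₁ (inj₁ ε<0)))
    where ε<0 = subst Positive (trans (signed-suc n (ε (suc n))) (cong -ᵠ_ (id (ε (suc n))))) (ε-sign (suc n))

  -- If mφ − a (1 ≤ m < Fₙ) has the sign of εₙ, then |mφ − a| > |εₙ|.
  BestApproximationAt : ℕ → Set
  BestApproximationAt n = ∀ a m → 1 ℕ.≤ m → m ℕ.< fib n →
    Positive (signed n (δ (+ a) m)) → Positive (signed n (δ (+ a) m -ᵠ ε n))

  φ·-preserves-signed : ∀ n {p} → Positive (signed (suc n) p) → Positive (signed n (-ᵠ φ· p))
  φ·-preserves-signed n {p} P = subst Positive (φ·-signed-suc n p) (positive-φ· P)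

  -- For a ≤ m, mφ − a = (m − a) + (m − 1)(φ − 1) + ε₁ > 0: this excludes even n (εₙ < 0),
  -- and for odd n, εₙ ≤ ε₁ gives the claim.
  best-approximation-≤ : ∀ k {a m} → a ℕ.≤ m → 1 ℕ.≤ m → m ℕ.< fib (suc k) →
    Positive (signed (suc k) (δ (+ a) m)) → Positive (signed (suc k) (δ (+ a) m -ᵠ ε (suc k)))
  best-approximation-≤ k {a} {suc m₀} a≤m _ m<F P with parity (suc k)
  ... | even neg = ⊥-elim (positive⇒¬positive-neg (δ-positive-≤ a≤m (s≤s z≤n)) (subst Positive (neg _) P))
  ... | odd id ε≤ε₁ with ℕ.m≤n⇒∃[o]m+o≡n a≤m
  ...   | j , a+j≡m = subst Positive (sym (id _)) (nonNegative∧≢0⇒positive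
            (subst NonNegative (sym (split (ε (suc k))))
                   (nonNegative-+ᵠ (nonNegative-+ᵠ (nonNegative-integer j) (nonNegative-δ-diagonal m₀)) ε≤ε₁))
            (λ eq → ℕ.<-irrefl (ℤ.+-injective (ℤ.i-j≡0⇒i≡j _ _ (⟨⟩-injectiveʳ eq))) m<F))
    where
    a≡m-j : + a ≡ + 1 + + m₀ - + j
    a≡m-j = trans (sym (cancel (+ a) (+ j))) (cong (_- + j) (cong +_ a+j≡m))
      where cancel : ∀ A J → (A + J) - J ≡ A
            cancel = solve-∀
    first : ∀ M J x → - (+ 1 + M - J) + - x ≡ (J + - M) + (- + 1 + - x)
    first = solve-∀
    second : ∀ M y → (+ 1 + M) + - y ≡ (+ 0 + M) + (+ 1 + - y)
    second = solve-∀
    split : ∀ X → δ (+ a) (suc m₀) -ᵠ X ≡ (⟨ + j , + 0 ⟩ +ᵠ ⟨ - + m₀ , + m₀ ⟩) +ᵠ (ε 1 -ᵠ X)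
    split ⟨ x , y ⟩ = cong₂ ⟨_,_⟩ (trans (cong (λ A → - A + - x) a≡m-j) (first (+ m₀) (+ j) x)) (second (+ m₀) y)

  -- Multiplying by −φ turns the data (m + r, m) at step k + 1 into (m, r) at step k.
  best-approximation-step : ∀ k → BestApproximationAt k → ∀ {a m r} → m ℕ.+ r ≡ a → 1 ℕ.≤ r → r ℕ.< fib k →
    Positive (signed (suc k) (δ (+ a) m)) → Positive (signed (suc k) (δ (+ a) m -ᵠ ε (suc k)))
  best-approximation-step k IH {m = m} {r} refl 1≤r r<F P =
    φ·-reflects-signed k (cong (signed k) (sym rescale-ε))
      (IH m r 1≤r r<F (subst (Positive ∘ signed k) rescale (φ·-preserves-signed k P)))
    where
    rescale : -ᵠ φ· δ (+ (m ℕ.+ r)) m ≡ δ (+ m) r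
    rescale = trans (cong -ᵠ_ (φ·δ-swap m r)) (-ᵠ-involutive _)
    first : ∀ M F₁ → - (M + - F₁) ≡ - M + - - F₁
    first = solve-∀
    second : ∀ M R F₁ F₀ → - ((- (M + R) + - - (F₁ + F₀)) + (M + - F₁)) ≡ R + - F₀
    second = solve-∀
    rescale-ε : -ᵠ φ· (δ (+ (m ℕ.+ r)) m -ᵠ ε (suc k)) ≡ δ (+ m) r -ᵠ ε k
    rescale-ε = cong₂ ⟨_,_⟩ (first (+ m) (+ fib (suc k))) (second (+ m) (+ r) (+ fib (suc k)) (+ fib k))

  -- With a = m + Fₙ₋₁ + t and Fₙ = m + j + 1, −(mφ − a − εₙ) = (j + 1)(φ − 1) + t > 0 settles even n,
  -- while for odd n, (mφ − a) + (ε₁ − εₙ) + j(φ − 1) + t = 0 contradicts mφ − a > 0.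
  best-approximation-large : ∀ k {a m r t} → m ℕ.+ r ≡ a → fib k ℕ.+ t ≡ r → 1 ℕ.≤ m → m ℕ.< fib (suc k) →
    Positive (signed (suc k) (δ (+ a) m)) → Positive (signed (suc k) (δ (+ a) m -ᵠ ε (suc k)))
  best-approximation-large k {m = m} {t = t} refl refl _ m<F P with ℕ.m≤n⇒∃[o]m+o≡n m<F
  ... | j , m+j≡F with parity (suc k)
  ...   | even neg = subst Positive (sym (trans (neg _) (balance (cong +_ (sym m+j≡F)))))
                       (positive+nonNegative (δ-positive-≤ ℕ.≤-refl (s≤s z≤n)) (nonNegative-integer t))
    where
    balance : ∀ {F₁} → F₁ ≡ + 1 + + m + + j →
              -ᵠ (δ (+ m + (+ fib k + + t)) m -ᵠ ⟨ - (F₁ + + fib k) , F₁ ⟩) ≡ ⟨ - (+ 1 + + j) , + 1 + + j ⟩ +ᵠ ⟨ + t , + 0 ⟩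
    balance refl = cong₂ ⟨_,_⟩ (first (+ m) (+ fib k) (+ t) (+ j)) (second (+ m) (+ j))
      where
      first : ∀ M F₀ T J → - (- (M + (F₀ + T)) + - - ((+ 1 + M + J) + F₀)) ≡ - (+ 1 + J) + T
      first = solve-∀
      second : ∀ M J → - (M + - (+ 1 + M + J)) ≡ (+ 1 + J) + + 0
      second = solve-∀
  ...   | odd id ε≤ε₁ = ⊥-elim (¬positive-0ᵠ (subst Positive (cancel (cong +_ (sym m+j≡F)))
            (positive+nonNegative (positive+nonNegative (positive+nonNegative (subst Positive (id _) P) ε≤ε₁)
                                                        (nonNegative-δ-diagonal j))
                                  (nonNegative-integer t))))
    where
    cancel : ∀ {F₁} → F₁ ≡ + 1 + + m + + j →
             ((δ (+ m + (+ fib k + + t)) m +ᵠ (ε 1 -ᵠ ⟨ - (F₁ + + fib k) , F₁ ⟩)) +ᵠ ⟨ - + j , + j ⟩) +ᵠ ⟨ + t , + 0 ⟩ ≡ 0ᵠ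
    cancel refl = cong₂ ⟨_,_⟩ (first (+ m) (+ fib k) (+ t) (+ j)) (second (+ m) (+ j))
      where
      first : ∀ M F₀ T J → ((- (M + (F₀ + T)) + (- + 1 + - - ((+ 1 + M + J) + F₀))) + - J) + T ≡ + 0
      first = solve-∀
      second : ∀ M J → ((M + (+ 1 + - (+ 1 + M + J))) + J) + + 0 ≡ + 0
      second = solve-∀

  best-approximation : ∀ n → BestApproximationAt n
  best-approximation zero    _ _ _   ()
  best-approximation (suc k) a m 1≤m m<F with a ℕ.≤? m | a ℕ.∸ m ℕ.<? fib k
  ... | yes a≤m | _       = best-approximation-≤ k a≤m 1≤m m<F
  ... | no a≰m  | yes r<F = best-approximation-step k (best-approximation k) (ℕ.m+[n∸m]≡n (ℕ.≰⇒≥ a≰m))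
                              (ℕ.m<n⇒0<n∸m (ℕ.≰⇒> a≰m)) r<F
  ... | no a≰m  | no r≮F  = best-approximation-large k (ℕ.m+[n∸m]≡n (ℕ.≰⇒≥ a≰m))
                              (proj₂ (ℕ.m≤n⇒∃[o]m+o≡n (ℕ.≮⇒≥ r≮F))) 1≤m m<F

module FloorSymmetry where

  open GoldenIntegers
  open GoldenFloor
  open BestApproximation
  open import Data.Nat as ℕ using (suc)
  import Data.Nat.Properties as ℕ
  open import Data.Integer using (ℤ; +_; _+_; -_; _-_)
  import Data.Integer.Properties as ℤ
  open import Data.Integer.Tactic.RingSolver using (solve-∀)
  open import Data.Product using (_,_; proj₁; proj₂)
  open import Data.Sum using (inj₁)
  open import Relation.Binary.PropositionalEquality

  δ-floor-positive : ∀ x → 1 ℕ.≤ x → Positive (δ (+ h x) x)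
  δ-floor-positive x 1≤x = nonNegative∧≢0⇒positive (proj₁ (h-isFloor x))
                             λ eq → ℕ.<⇒≢ 1≤x (sym (ℤ.+-injective (⟨⟩-injectiveʳ eq)))

  -- xφ − ⌊xφ⌋ − 1 < εₙ < xφ − ⌊xφ⌋: the bound of the same sign as εₙ is best approximation,
  -- the other one holds by signs alone.
  ε-lower-bound : ∀ n x → 1 ℕ.≤ x → x ℕ.< fib n → Positive (ε n -ᵠ δ (+ suc (h x)) x)
  ε-lower-bound n x 1≤x x<F with parity n
  ... | odd id _ = positive-+ᵠ (subst Positive (id (ε n)) (ε-sign n)) (proj₂ (h-isFloor x))
  ... | even neg = subst Positive (trans (neg _) (cong₂ ⟨_,_⟩ (first (+ suc (h x)) (+ fib (suc n))) (second (+ x) (+ fib n))))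
                     (best-approximation n (suc (h x)) x 1≤x x<F
                        (subst Positive (sym (neg (δ (+ suc (h x)) x))) (proj₂ (h-isFloor x))))
    where first : ∀ A F₁ → - (- A + - - F₁) ≡ - F₁ + - - A
          first = solve-∀
          second : ∀ X F → - (X + - F) ≡ F + - X
          second = solve-∀

  ε-upper-bound : ∀ n x → 1 ℕ.≤ x → x ℕ.< fib n → Positive (δ (+ h x) x -ᵠ ε n)
  ε-upper-bound n x 1≤x x<F with parity n
  ... | odd id _ = subst Positive (id _)
                     (best-approximation n (h x) x 1≤x x<F (subst Positive (sym (id _)) (δ-floor-positive x 1≤x)))
  ... | even neg = positive-+ᵠ (δ-floor-positive x 1≤x) (subst Positive (neg (ε n)) (ε-sign n))

  -- Fₙ₊₁ − 1 − ⌊xφ⌋ ≤ (Fₙ − x)φ < Fₙ₊₁ − ⌊xφ⌋ is a rewriting of the two bounds, since Fₙφ = Fₙ₊₁ + εₙ.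
  floor-symmetry : ∀ n x → 1 ℕ.≤ x → x ℕ.< fib n → suc (h x ℕ.+ h (fib n ℕ.∸ x)) ≡ fib (suc n)
  floor-symmetry n x 1≤x x<F = ℤ.+-injective (begin
    + suc (h x ℕ.+ h j)   ≡⟨ cong (λ z → + 1 + (A + z)) (floor-unique (h-isFloor j) isFloor) ⟩
    + 1 + (A + c)         ≡⟨ cancel A F₁ ⟩
    F₁                    ∎)
    where
    open ≡-Reasoning
    j = fib n ℕ.∸ x
    A = + h x
    F₁ = + fib (suc n)
    c = F₁ - (+ 1 + A)
    cancel : ∀ A F₁ → + 1 + (A + (F₁ - (+ 1 + A))) ≡ F₁
    cancel = solve-∀
    j≡F-x : + j ≡ + fib n - + x
    j≡F-x = trans (sym (drop (+ j) (+ x))) (cong (λ z → + z - + x) (ℕ.m∸n+n≡m (ℕ.<⇒≤ x<F)))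
      where drop : ∀ J X → (J + X) - X ≡ J
            drop = solve-∀
    first : ∀ A F₁ → - F₁ + - - (+ 1 + A) ≡ - (F₁ - (+ 1 + A))
    first = solve-∀
    second : ∀ A F₁ → - A + - - F₁ ≡ - - (+ 1 + (F₁ - (+ 1 + A)))
    second = solve-∀
    third : ∀ X F → X + - F ≡ - (F - X)
    third = solve-∀
    isFloor : IsFloor j c
    isFloor = inj₁ (subst Positive (cong₂ ⟨_,_⟩ (first A F₁) (sym j≡F-x)) (ε-lower-bound n x 1≤x x<F)) ,
              subst Positive (cong₂ ⟨_,_⟩ (second A F₁) (trans (third (+ x) (+ fib n)) (cong -_ (sym j≡F-x))))
                             (ε-upper-bound n x 1≤x x<F)

module Words where

  open import Data.Nat using (ℕ; zero; suc; _+_; _∸_; _<_; z≤n; s≤s)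
  open import Data.Nat.Properties using (+-identityʳ; +-suc; n∸n≡0)
  open import Data.List using ([]; _∷_; _++_; [_]; replicate; reverse)
  open import Data.List.Properties using (++-assoc; ++-identityʳ; reverse-++; unfold-reverse)
  open import Data.Product using (_,_)
  open import Function using (_∘_)
  open import Relation.Binary.PropositionalEquality hiding ([_])

  block⁰¹ : ℕ → Word
  block⁰¹ k = replicate k 0 ++ [ 1 ]

  block¹⁰ : ℕ → Word
  block¹⁰ k = 1 ∷ replicate k 0

  blocks⁰¹ : (ℕ → ℕ) → ℕ → Word
  blocks⁰¹ e zero    = []
  blocks⁰¹ e (suc L) = block⁰¹ (e 0) ++ blocks⁰¹ (e ∘ suc) L

  blocks¹⁰ : (ℕ → ℕ) → ℕ → Word
  blocks¹⁰ e zero    = []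
  blocks¹⁰ e (suc L) = block¹⁰ (e 0) ++ blocks¹⁰ (e ∘ suc) L

  blocks⁰¹-cong : ∀ L {e e′} → (∀ i → i < L → e i ≡ e′ i) → blocks⁰¹ e L ≡ blocks⁰¹ e′ L
  blocks⁰¹-cong zero    eq = refl
  blocks⁰¹-cong (suc L) eq =
    cong₂ (λ k w → block⁰¹ k ++ w) (eq 0 (s≤s z≤n)) (blocks⁰¹-cong L (λ i i<L → eq (suc i) (s≤s i<L)))

  blocks¹⁰-cong : ∀ L {e e′} → (∀ i → i < L → e i ≡ e′ i) → blocks¹⁰ e L ≡ blocks¹⁰ e′ L
  blocks¹⁰-cong zero    eq = refl
  blocks¹⁰-cong (suc L) eq =
    cong₂ (λ k w → block¹⁰ k ++ w) (eq 0 (s≤s z≤n)) (blocks¹⁰-cong L (λ i i<L → eq (suc i) (s≤s i<L)))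

  blocks⁰¹-snoc : ∀ L e → blocks⁰¹ e (suc L) ≡ blocks⁰¹ e L ++ block⁰¹ (e L)
  blocks⁰¹-snoc zero    e = ++-identityʳ _
  blocks⁰¹-snoc (suc L) e =
    trans (cong (block⁰¹ (e 0) ++_) (blocks⁰¹-snoc L (e ∘ suc))) (sym (++-assoc (block⁰¹ (e 0)) _ _))

  blocks¹⁰-snoc : ∀ L e → blocks¹⁰ e (suc L) ≡ blocks¹⁰ e L ++ block¹⁰ (e L)
  blocks¹⁰-snoc zero    e = ++-identityʳ _
  blocks¹⁰-snoc (suc L) e =
    trans (cong (block¹⁰ (e 0) ++_) (blocks¹⁰-snoc L (e ∘ suc))) (sym (++-assoc (block¹⁰ (e 0)) _ _))

  1∷blocks⁰¹ : ∀ L e → 1 ∷ blocks⁰¹ e L ≡ blocks¹⁰ e L ++ [ 1 ]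
  1∷blocks⁰¹ zero    e = refl
  1∷blocks⁰¹ (suc L) e = cong (1 ∷_) (begin
    (zeros ++ [ 1 ]) ++ blocks⁰¹ (e ∘ suc) L     ≡⟨ ++-assoc zeros _ _ ⟩
    zeros ++ 1 ∷ blocks⁰¹ (e ∘ suc) L            ≡⟨ cong (zeros ++_) (1∷blocks⁰¹ L (e ∘ suc)) ⟩
    zeros ++ (blocks¹⁰ (e ∘ suc) L ++ [ 1 ])     ≡⟨ ++-assoc zeros _ _ ⟨
    (zeros ++ blocks¹⁰ (e ∘ suc) L) ++ [ 1 ]     ∎)
    where
    open ≡-Reasoning
    zeros = replicate (e 0) 0

  reverse-replicate : ∀ {A : Set} k (x : A) → reverse (replicate k x) ≡ replicate k x
  reverse-replicate zero    x = refl
  reverse-replicate (suc k) x = begin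
    reverse (x ∷ replicate k x)  ≡⟨ unfold-reverse x (replicate k x) ⟩
    reverse (replicate k x) ++ [ x ] ≡⟨ cong (_++ [ x ]) (reverse-replicate k x) ⟩
    replicate k x ++ [ x ]       ≡⟨ snoc k ⟩
    x ∷ replicate k x            ∎
    where
    open ≡-Reasoning
    snoc : ∀ k → replicate k x ++ [ x ] ≡ x ∷ replicate k x
    snoc zero    = refl
    snoc (suc k) = cong (x ∷_) (snoc k)

  reverse-block⁰¹ : ∀ k → reverse (block⁰¹ k) ≡ block¹⁰ k
  reverse-block⁰¹ k = trans (reverse-++ (replicate k 0) [ 1 ]) (cong (1 ∷_) (reverse-replicate k 0))

  run : ℕ → ℕ
  run m = h (suc m) ∸ h m

  fibPrefix-+ : ∀ N L → fibPrefix (N + L) ≡ fibPrefix N ++ blocks⁰¹ (λ i → run (N + i)) L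
  fibPrefix-+ N zero    = trans (cong fibPrefix (+-identityʳ N)) (sym (++-identityʳ _))
  fibPrefix-+ N (suc L) = begin
    fibPrefix (N + suc L)                                                ≡⟨ cong fibPrefix (+-suc N L) ⟩
    fibPrefix (suc N + L)                                                ≡⟨ fibPrefix-+ (suc N) L ⟩
    (fibPrefix N ++ block⁰¹ (run N)) ++ blocks⁰¹ (λ i → run (suc N + i)) L ≡⟨ ++-assoc (fibPrefix N) _ _ ⟩
    fibPrefix N ++ (block⁰¹ (run N) ++ blocks⁰¹ (λ i → run (suc N + i)) L) ≡⟨ cong (fibPrefix N ++_) reindex ⟩
    fibPrefix N ++ blocks⁰¹ (λ i → run (N + i)) (suc L)                  ∎
    where
    open ≡-Reasoning
    reindex = cong₂ (λ k w → block⁰¹ k ++ w) (cong run (sym (+-identityʳ N)))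
                    (blocks⁰¹-cong L (λ i _ → cong run (sym (+-suc N i))))

  reverse-fibPrefix : ∀ M → reverse (fibPrefix M) ≡ blocks¹⁰ (λ i → run (M ∸ suc i)) M
  reverse-fibPrefix zero    = refl
  reverse-fibPrefix (suc M) = trans (reverse-++ (fibPrefix M) (block⁰¹ (run M)))
                                    (cong₂ _++_ (reverse-block⁰¹ (run M)) (reverse-fibPrefix M))

  -- Runs N, …, N + M′ − 1 mirror runs M′, …, 1, and run 0 = 1 is matched by the first 0 of run N + M′.
  reverse-fibPrefix-occurs : ∀ N′ M′ q → run (suc N′ + M′) ≡ suc q →
                             (∀ i → i < M′ → run (suc N′ + i) ≡ run (suc M′ ∸ suc i)) →
                             FactorOf (reverse (fibPrefix (suc M′))) (fibPrefix (suc N′ + suc M′))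
  reverse-fibPrefix-occurs N′ M′ q last≡1+q mirror = P , block⁰¹ q , sym (begin
    fibPrefix (N + suc M′)                               ≡⟨ fibPrefix-+ N (suc M′) ⟩
    fibPrefix N ++ blocks⁰¹ g (suc M′)                   ≡⟨ cong (fibPrefix N ++_) (blocks⁰¹-snoc M′ g) ⟩
    fibPrefix N ++ (blocks⁰¹ g M′ ++ block⁰¹ (g M′))     ≡⟨ move-1 (blocks⁰¹ g M′ ++ block⁰¹ (g M′)) ⟩
    P ++ (1 ∷ blocks⁰¹ g M′ ++ block⁰¹ (g M′))           ≡⟨ cong (λ w → P ++ (w ++ block⁰¹ (g M′))) (1∷blocks⁰¹ M′ g) ⟩
    P ++ ((blocks¹⁰ g M′ ++ [ 1 ]) ++ block⁰¹ (g M′))    ≡⟨ cong₂ (λ w k → P ++ ((w ++ [ 1 ]) ++ block⁰¹ k))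
                                                                  (blocks¹⁰-cong M′ mirror) last≡1+q ⟩
    P ++ ((R ++ [ 1 ]) ++ block⁰¹ (suc q))               ≡⟨ cong (P ++_) (++-assoc R [ 1 ] _) ⟩
    P ++ (R ++ block¹⁰ 1 ++ block⁰¹ q)                   ≡⟨ cong (P ++_) (++-assoc R (block¹⁰ 1) _) ⟨
    P ++ ((R ++ block¹⁰ 1) ++ block⁰¹ q)                 ≡⟨ cong (λ w → P ++ (w ++ block⁰¹ q)) reversed ⟨
    P ++ reverse (fibPrefix (suc M′)) ++ block⁰¹ q       ∎)
    where
    open ≡-Reasoning
    N = suc N′
    g = λ i → run (N + i)
    f = λ i → run (suc M′ ∸ suc i)
    P = fibPrefix N′ ++ replicate (run N′) 0
    R = blocks¹⁰ f M′
    move-1 : ∀ w → fibPrefix N ++ w ≡ P ++ (1 ∷ w)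
    move-1 w = begin
      (fibPrefix N′ ++ (replicate (run N′) 0 ++ [ 1 ])) ++ w ≡⟨ ++-assoc (fibPrefix N′) _ w ⟩
      fibPrefix N′ ++ ((replicate (run N′) 0 ++ [ 1 ]) ++ w) ≡⟨ cong (fibPrefix N′ ++_) (++-assoc (replicate (run N′) 0) [ 1 ] w) ⟩
      fibPrefix N′ ++ (replicate (run N′) 0 ++ 1 ∷ w)        ≡⟨ ++-assoc (fibPrefix N′) _ _ ⟨
      P ++ (1 ∷ w)                                           ∎
    reversed : reverse (fibPrefix (suc M′)) ≡ R ++ block¹⁰ 1
    reversed = trans (reverse-fibPrefix (suc M′))
                     (trans (blocks¹⁰-snoc M′ f) (cong (λ k → R ++ block¹⁰ (run k)) (n∸n≡0 M′)))

module Insertion where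

  open import Data.Nat using (ℕ; zero; suc)
  open import Data.Bool using (Bool; true; false; _∧_)
  open import Data.Bool.Properties using (∧-comm)
  open import Data.List using ([]; _∷_; _++_; [_]; reverse)
  open import Data.List.Properties using (++-assoc; reverse-++; unfold-reverse)
  open import Data.Product using (_,_)
  open import Relation.Binary.PropositionalEquality hiding ([_])

  FactorOf-trans : ∀ {u v w} → FactorOf u v → FactorOf v w → FactorOf u w
  FactorOf-trans {u} (xs , ys , refl) (xs′ , ys′ , refl) = xs′ ++ xs , ys ++ ys′ , (begin
    (xs′ ++ xs) ++ u ++ ys ++ ys′    ≡⟨ ++-assoc xs′ xs _ ⟩
    xs′ ++ xs ++ u ++ ys ++ ys′      ≡⟨ cong (λ w → xs′ ++ xs ++ w) (++-assoc u ys ys′) ⟨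
    xs′ ++ xs ++ (u ++ ys) ++ ys′    ≡⟨ cong (xs′ ++_) (++-assoc xs (u ++ ys) ys′) ⟨
    xs′ ++ (xs ++ u ++ ys) ++ ys′    ∎)
    where open ≡-Reasoning

  FactorOf-reverse : ∀ {u w} → FactorOf u w → FactorOf (reverse u) (reverse w)
  FactorOf-reverse {u} (xs , ys , refl) = reverse ys , reverse xs , (begin
    reverse ys ++ reverse u ++ reverse xs    ≡⟨ ++-assoc (reverse ys) _ _ ⟨
    (reverse ys ++ reverse u) ++ reverse xs  ≡⟨ cong (_++ reverse xs) (reverse-++ u ys) ⟨
    reverse (u ++ ys) ++ reverse xs          ≡⟨ reverse-++ xs (u ++ ys) ⟨
    reverse (xs ++ u ++ ys)                  ∎)
    where open ≡-Reasoning

  isZero : ℕ → Bool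
  isZero zero    = true
  isZero (suc _) = false

  startsWith0 : Word → Bool
  startsWith0 []      = false
  startsWith0 (x ∷ _) = isZero x

  endsWith0 : Word → Bool
  endsWith0 []          = false
  endsWith0 (x ∷ [])    = isZero x
  endsWith0 (_ ∷ y ∷ w) = endsWith0 (y ∷ w)

  2-if : Bool → Word
  2-if true  = [ 2 ]
  2-if false = []

  junction : Word → Word → Word
  junction u v = 2-if (endsWith0 u ∧ startsWith0 v)

  ins2-∷ : ∀ x w → ins2 (x ∷ w) ≡ x ∷ junction [ x ] w ++ ins2 w
  ins2-∷ zero    []          = refl
  ins2-∷ zero    (zero ∷ w)  = refl
  ins2-∷ zero    (suc _ ∷ w) = refl
  ins2-∷ (suc _) w           = refl

  ins2-[x] : ∀ x → ins2 [ x ] ≡ [ x ]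
  ins2-[x] zero    = refl
  ins2-[x] (suc _) = refl

  ins2-++ : ∀ u v → ins2 (u ++ v) ≡ ins2 u ++ junction u v ++ ins2 v
  ins2-++ []          v = refl
  ins2-++ (x ∷ [])    v = trans (ins2-∷ x v) (cong (_++ junction [ x ] v ++ ins2 v) (sym (ins2-[x] x)))
  ins2-++ (x ∷ y ∷ u) v = begin
    ins2 (x ∷ y ∷ u ++ v)                                   ≡⟨ ins2-∷ x (y ∷ u ++ v) ⟩
    x ∷ j ++ ins2 (y ∷ u ++ v)                              ≡⟨ cong (λ w → x ∷ j ++ w) (ins2-++ (y ∷ u) v) ⟩
    x ∷ j ++ ins2 (y ∷ u) ++ junction (y ∷ u) v ++ ins2 v   ≡⟨ cong (x ∷_) (++-assoc j (ins2 (y ∷ u)) _) ⟨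
    (x ∷ j ++ ins2 (y ∷ u)) ++ junction (y ∷ u) v ++ ins2 v ≡⟨ cong (_++ junction (y ∷ u) v ++ ins2 v) (ins2-∷ x (y ∷ u)) ⟨
    ins2 (x ∷ y ∷ u) ++ junction (x ∷ y ∷ u) v ++ ins2 v    ∎
    where
    open ≡-Reasoning
    j = junction [ x ] (y ∷ u)

  endsWith0-∷ʳ : ∀ w x → endsWith0 (w ++ [ x ]) ≡ isZero x
  endsWith0-∷ʳ []          x = refl
  endsWith0-∷ʳ (_ ∷ [])    x = refl
  endsWith0-∷ʳ (_ ∷ y ∷ w) x = endsWith0-∷ʳ (y ∷ w) x

  endsWith0-reverse : ∀ w → endsWith0 (reverse w) ≡ startsWith0 w
  endsWith0-reverse []      = refl
  endsWith0-reverse (x ∷ w) = trans (cong endsWith0 (unfold-reverse x w)) (endsWith0-∷ʳ (reverse w) x)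

  reverse-2-if : ∀ b → reverse (2-if b) ≡ 2-if b
  reverse-2-if true  = refl
  reverse-2-if false = refl

  junction-reverse : ∀ x w → junction (reverse w) [ x ] ≡ reverse (junction [ x ] w)
  junction-reverse x w = begin
    2-if (endsWith0 (reverse w) ∧ isZero x)  ≡⟨ cong (λ b → 2-if (b ∧ isZero x)) (endsWith0-reverse w) ⟩
    2-if (startsWith0 w ∧ isZero x)          ≡⟨ cong 2-if (∧-comm (startsWith0 w) (isZero x)) ⟩
    2-if (isZero x ∧ startsWith0 w)          ≡⟨ reverse-2-if _ ⟨
    reverse (junction [ x ] w)               ∎
    where open ≡-Reasoning

  ins2-reverse : ∀ w → ins2 (reverse w) ≡ reverse (ins2 w)
  ins2-reverse []      = refl
  ins2-reverse (x ∷ w) = begin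
    ins2 (reverse (x ∷ w))                                ≡⟨ cong ins2 (unfold-reverse x w) ⟩
    ins2 (reverse w ++ [ x ])                             ≡⟨ ins2-++ (reverse w) [ x ] ⟩
    ins2 (reverse w) ++ junction (reverse w) [ x ] ++ ins2 [ x ]
        ≡⟨ cong₂ (λ u v → u ++ v ++ ins2 [ x ]) (ins2-reverse w) (junction-reverse x w) ⟩
    reverse (ins2 w) ++ reverse j ++ ins2 [ x ]           ≡⟨ cong (λ v → reverse (ins2 w) ++ reverse j ++ v) (ins2-[x] x) ⟩
    reverse (ins2 w) ++ reverse j ++ [ x ]                ≡⟨ ++-assoc (reverse (ins2 w)) (reverse j) _ ⟨
    (reverse (ins2 w) ++ reverse j) ++ [ x ]              ≡⟨ cong (_++ [ x ]) (reverse-++ j (ins2 w)) ⟨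
    reverse (j ++ ins2 w) ++ [ x ]                        ≡⟨ unfold-reverse x (j ++ ins2 w) ⟨
    reverse (x ∷ j ++ ins2 w)                             ≡⟨ cong reverse (ins2-∷ x w) ⟨
    reverse (ins2 (x ∷ w))                                ∎
    where
    open ≡-Reasoning
    j = junction [ x ] w

  ins2-preserves-FactorOf : ∀ {u w} → FactorOf u w → FactorOf (ins2 u) (ins2 w)
  ins2-preserves-FactorOf {u} (xs , ys , refl) = ins2 xs ++ junction xs (u ++ ys) , junction u ys ++ ins2 ys , (begin
    (ins2 xs ++ j₁) ++ ins2 u ++ j₂ ++ ins2 ys   ≡⟨ ++-assoc (ins2 xs) j₁ _ ⟩
    ins2 xs ++ j₁ ++ ins2 u ++ j₂ ++ ins2 ys     ≡⟨ cong (λ w → ins2 xs ++ j₁ ++ w) (ins2-++ u ys) ⟨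
    ins2 xs ++ j₁ ++ ins2 (u ++ ys)              ≡⟨ ins2-++ xs (u ++ ys) ⟨
    ins2 (xs ++ u ++ ys)                         ∎)
    where
    open ≡-Reasoning
    j₁ = junction xs (u ++ ys)
    j₂ = junction u ys

module ReversedPrefixes where

  open GoldenFloor
  open BestApproximation using (fib; fib-≥)
  open FloorSymmetry
  open Words
  open Insertion
  open import Data.Nat as ℕ using (ℕ; zero; suc; _+_; _∸_; _≤_; _<_; z≤n; s≤s)
  import Data.Nat.Properties as ℕ
  open import Data.Nat.Tactic.RingSolver using (solve-∀)
  open import Data.List using ([]; reverse)
  open import Data.Product using (∃; _,_; proj₁; proj₂)
  open import Relation.Binary.PropositionalEquality

  run-positive : ∀ m → ∃ λ q → run m ≡ suc q
  run-positive m = q , trans (cong (_∸ h m) (proj₂ (h-increasing m))) (ℕ.m+n∸m≡n (h m) (suc q))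
    where q = proj₁ (h-increasing m)

  ∸-exchange : ∀ {a b c d} → a + b ≡ c + d → c ∸ a ≡ b ∸ d
  ∸-exchange {a} {b} {c} {d} eq = begin
    c ∸ a              ≡⟨ ℕ.[m+n]∸[m+o]≡n∸o d c a ⟨
    (d + c) ∸ (d + a)  ≡⟨ cong₂ _∸_ (trans (ℕ.+-comm d c) (sym eq)) (ℕ.+-comm d a) ⟩
    (a + b) ∸ (a + d)  ≡⟨ ℕ.[m+n]∸[m+o]≡n∸o a b d ⟩
    b ∸ d              ∎
    where open ≡-Reasoning

  run-symmetry : ∀ n {x y} → 1 ≤ x → 1 ≤ y → x + suc y ≡ fib n → run x ≡ run y
  run-symmetry n {x} {y} 1≤x 1≤y x+1+y≡F = ∸-exchange {h x} {h (suc y)} {h (suc x)} {h y} (ℕ.suc-injective (begin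
    suc (h x + h (suc y))          ≡⟨ cong (λ z → suc (h x + h z)) F-x≡1+y ⟨
    suc (h x + h (fib n ∸ x))      ≡⟨ floor-symmetry n x 1≤x x<F ⟩
    fib (suc n)                    ≡⟨ floor-symmetry n (suc x) (s≤s z≤n) 1+x<F ⟨
    suc (h (suc x) + h (fib n ∸ suc x)) ≡⟨ cong (λ z → suc (h (suc x) + h z)) F-1-x≡y ⟩
    suc (h (suc x) + h y)          ∎))
    where
    open ≡-Reasoning
    x+1+y≡1+x+y = ℕ.+-suc x y
    x<F = subst (x <_) x+1+y≡F (ℕ.m<m+n x (s≤s z≤n))
    1+x<F = subst (suc x <_) (trans (sym x+1+y≡1+x+y) x+1+y≡F) (ℕ.m<m+n (suc x) 1≤y)
    F-x≡1+y = trans (cong (_∸ x) (sym x+1+y≡F)) (ℕ.m+n∸m≡n x (suc y))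
    F-1-x≡y = trans (cong (_∸ suc x) (trans (sym x+1+y≡F) x+1+y≡1+x+y)) (ℕ.m+n∸m≡n (suc x) y)

  -- Choose N with N + M = Fₙ; the run symmetry then makes the hypotheses of reverse-fibPrefix-occurs hold.
  reverse-fibPrefix-factor : ∀ M → ∃ λ K → FactorOf (reverse (fibPrefix M)) (fibPrefix K)
  reverse-fibPrefix-factor zero     = 0 , [] , [] , refl
  reverse-fibPrefix-factor (suc M′) with ℕ.m≤n⇒∃[o]m+o≡n (fib-≥ (suc M′))
  ... | N′ , 2+M′+N′≡F = suc N′ + suc M′ , reverse-fibPrefix-occurs N′ M′ q last≡1+q mirror
    where
    n = suc (suc (suc M′))
    q = proj₁ (run-positive (suc N′ + M′))
    last≡1+q = proj₂ (run-positive (suc N′ + M′))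
    N+M≡F : suc N′ + suc M′ ≡ fib n
    N+M≡F = trans (cong suc (ℕ.+-comm N′ (suc M′))) 2+M′+N′≡F
    mirror : ∀ i → i < M′ → run (suc N′ + i) ≡ run (suc M′ ∸ suc i)
    mirror i i<M′ = sym (run-symmetry n (ℕ.m<n⇒0<n∸m i<M′) (s≤s z≤n) (begin
      (M′ ∸ i) + suc (suc N′ + i)  ≡⟨ shuffle (M′ ∸ i) N′ i ⟩
      suc N′ + suc (M′ ∸ i + i)    ≡⟨ cong (λ m → suc N′ + suc m) (ℕ.m∸n+n≡m (ℕ.<⇒≤ i<M′)) ⟩
      suc N′ + suc M′              ≡⟨ N+M≡F ⟩
      fib n                        ∎))
      where
      open ≡-Reasoning
      shuffle : ∀ d N i → d + suc (suc N + i) ≡ suc N + suc (d + i)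
      shuffle = solve-∀

open Insertion using (FactorOf-trans; FactorOf-reverse; ins2-reverse; ins2-preserves-FactorOf)
open ReversedPrefixes using (reverse-fibPrefix-factor)

mainTheorem5 : (u : Word) → FactorOfSM u → FactorOfSM (reverse u)
mainTheorem5 u (M , u≼SM) with reverse-fibPrefix-factor M
... | K , revF≼F = K , FactorOf-trans
  (subst (FactorOf (reverse u)) (sym (ins2-reverse (fibPrefix M))) (FactorOf-reverse u≼SM))
  (ins2-preserves-FactorOf revF≼F)
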